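{- Let $d\ge 1$ be an integer, let $G_1=(V_1,E_1)$ and $G_2=(V_2,E_2)$ be connected graphs with disjoint vertex sets, let $v_1\in V_1$, $v_2\in V_2$, and let $\mathbf{U}=[u_1,\dots,u_{k}]$ and $\mathbf{W}=[w_1,\dots,w_{k}]$ be sequences (possibly empty, repetitions allowed) of vertices of $V_1$ and $V_2$ respectively. Let $G'=M_{G_1}^{G_2}(v_1,v_2,\mathbf{U},\mathbf{W})$ be the merged graph. Then $OPT_d(G')\le OPT_d(G_1)+OPT_d(G_2)$.
   Context: Graphs are finite, simple, undirected; $d_G$ denotes shortest-path distance. A $d$-scattered set of $G$ is a set $K\subseteq V(G)$ with $d_G(u,w)\ge d$ for all distinct $u,w\in K$; $OPT_d(G)$ is its maximum size. The merged graph $M_{G_1}^{G_2}(v_1,v_2,\mathbf{U},\mathbf{W})$ is the graph $G'=(V',E')$ obtained as follows: (1) take the disjoint union of $G_1$ and $G_2$ and identify $v_1$ and $v_2$ into a single new vertex $v'$ (so $V'=(V_1\setminus\{v_1\})\cup(V_2\setminus\{v_2\})\cup\{v'\}$); (2) $E'$ contains all edges of $E_1$ and $E_2$, where every edge incident to $v_1$ or $v_2$ is made incident to $v'$ instead; (3) additionally, $E'$ contains an edge between $u_i$ and $w_i$ for each index $i$ (with $v'$ in place of $v_1$ or $v_2$ if these occur). -}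

module Defs where

open import Level using (0ℓ)
open import Data.Nat using (ℕ; zero; suc; _≤_)
open import Data.Fin using (Fin; _≟_)
open import Data.Sum using (_⊎_; inj₁; inj₂)
open import Data.Product using (Σ; Σ-syntax; ∃; ∃-syntax; _×_; _,_)
open import Data.List using (List; length)
open import Data.List.Membership.Propositional using (_∈_)
open import Data.List.Relation.Unary.Unique.Propositional using (Unique)
open import Relation.Nullary using (¬_; yes; no)
open import Relation.Nullary.Decidable using (False; fromWitnessFalse)
open import Relation.Binary.PropositionalEquality using (_≡_; _≢_)

record Graph : Set₁ where
  field
    n     : ℕ
    E     : Fin n → Fin n → Set
    E-sym : ∀ {x y} → E x y → E y x
    E-irr : ∀ {x} → ¬ E x x

data Walk {V : Set} (E : V → V → Set) : V → V → ℕ → Set where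
  [] : ∀ {x} → Walk E x x zero
  _∷_ : ∀ {x y z ℓ} → E x y → Walk E y z ℓ → Walk E x z (suc ℓ)

-- d_G(u,w) ≥ d : every walk (hence every shortest path) from u to w has length ≥ d
-- (d_G(u,w) = ∞ when no walk exists, which also satisfies ≥ d).
DistGE : {V : Set} → (V → V → Set) → ℕ → V → V → Set
DistGE E d u w = ∀ ℓ → Walk E u w ℓ → d ≤ ℓ

Connected : {V : Set} → (V → V → Set) → Set
Connected E = ∀ x y → ∃[ ℓ ] Walk E x y ℓ

Scattered : {V : Set} → (V → V → Set) → ℕ → List V → Set
Scattered E d K = Unique K × (∀ {u w} → u ∈ K → w ∈ K → u ≢ w → DistGE E d u w)

IsOPT : {V : Set} → (V → V → Set) → ℕ → ℕ → Set
IsOPT E d m = (Σ[ K ∈ List _ ] (Scattered E d K × length K ≡ m))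
            × (∀ K → Scattered E d K → length K ≤ m)

module Merge (G₁ G₂ : Graph) (v₁ : Fin (Graph.n G₁)) (v₂ : Fin (Graph.n G₂))
             {k : ℕ} (U : Fin k → Fin (Graph.n G₁)) (W : Fin k → Fin (Graph.n G₂)) where
  open Graph G₁ renaming (n to n₁; E to E₁)
  open Graph G₂ renaming (n to n₂; E to E₂)

  -- V' = V₁ ⊎ (V₂ ∖ {v₂}); the identified vertex v' is inj₁ v₁.
  V' : Set
  V' = Fin n₁ ⊎ Σ (Fin n₂) (λ x → False (x ≟ v₂))

  ι₁ : Fin n₁ → V'
  ι₁ = inj₁

  ι₂ : Fin n₂ → V'
  ι₂ x with x ≟ v₂
  ... | yes _ = inj₁ v₁
  ... | no p  = inj₂ (x , fromWitnessFalse p)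

  Extra : V' → V' → Set
  Extra a b = Σ[ i ∈ Fin k ] ((a ≡ ι₁ (U i) × b ≡ ι₂ (W i)) ⊎ (a ≡ ι₂ (W i) × b ≡ ι₁ (U i)))

  -- Edges of the merged graph (no loops: the graph is simple).
  E' : V' → V' → Set
  E' a b = a ≢ b ×
    ( (Σ[ x ∈ Fin n₁ ] Σ[ y ∈ Fin n₁ ] (E₁ x y × a ≡ ι₁ x × b ≡ ι₁ y))
    ⊎ (Σ[ x ∈ Fin n₂ ] Σ[ y ∈ Fin n₂ ] (E₂ x y × a ≡ ι₂ x × b ≡ ι₂ y))
    ⊎ Extra a b )

module Submission where

-- Every vertex of the merged graph G' comes from G₁ (via the
-- inclusion ι₁) or from G₂ (via ι₂, which sends v₂ to the merged vertex v').
-- Both inclusions are injective graph homomorphisms: each edge of Gᵢ is an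
-- edge of G'.  A homomorphism maps walks to walks of the same length, so it
-- never increases distances; hence the preimage of a d-scattered set of G'
-- under an injective homomorphism is d-scattered in the source graph.
-- Splitting a d-scattered set K of G' into the part coming from G₁ and the
-- part coming from G₂ therefore yields d-scattered sets of G₁ and G₂ whose
-- sizes add up to |K|, so |K| ≤ OPT_d(G₁) + OPT_d(G₂).

open import Defs
open import Data.Nat using (ℕ; _≤_; _+_; suc)
open import Data.Nat.Properties using (+-suc; +-mono-≤)
open import Data.Fin using (Fin; _≟_)
open import Data.Sum using (_⊎_; inj₁; inj₂; [_,_]′)
open import Data.Sum.Properties using (inj₁-injective; inj₂-injective)
open import Data.Product using (_,_; proj₁; proj₂)
open import Data.List using (List; []; _∷_; length; map)
open import Data.List.Properties using (length-map)
open import Data.List.Membership.Propositional using (_∈_)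
open import Data.List.Membership.Propositional.Properties using (∈-map⁻)
open import Data.List.Relation.Unary.Any using (here; there)
open import Data.List.Relation.Unary.All using (All; []; _∷_)
open import Data.List.Relation.Unary.AllPairs using ([]; _∷_)
open import Data.List.Relation.Unary.Unique.Propositional using (Unique)
import Data.List.Relation.Unary.Unique.Propositional.Properties as Unique
open import Data.Empty using (⊥-elim)
open import Relation.Nullary using (¬_; yes; no)
open import Relation.Nullary.Decidable using (toWitnessFalse)
open import Data.Bool.Properties using (T-irrelevant)
open import Relation.Binary.PropositionalEquality
  using (_≡_; _≢_; refl; sym; trans; cong; subst)

Homomorphism : {A B : Set} → (A → A → Set) → (B → B → Set) → (A → B) → Set
Homomorphism E F f = ∀ {x y} → E x y → F (f x) (f y)

Injective : {A B : Set} → (A → B) → Set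
Injective f = ∀ {x y} → f x ≡ f y → x ≡ y

mapWalk : {A B : Set} {E : A → A → Set} {F : B → B → Set} (f : A → B) →
  Homomorphism E F f → ∀ {x y ℓ} → Walk E x y ℓ → Walk F (f x) (f y) ℓ
mapWalk f hom []      = []
mapWalk f hom (e ∷ w) = hom e ∷ mapWalk f hom w

scattered-preimage : {A B : Set} {E : A → A → Set} {F : B → B → Set} {d : ℕ}
  (f : A → B) → Homomorphism E F f → Injective f →
  {K : List B} → Scattered F d K →
  {L : List A} → Unique L → (∀ {a} → a ∈ L → f a ∈ K) → Scattered E d L
scattered-preimage f hom inj (_ , farK) uniqueL into =
  uniqueL , λ u∈L w∈L u≢w ℓ walk →
    farK (into u∈L) (into w∈L) (λ fu≡fw → u≢w (inj fu≡fw)) ℓ (mapWalk f hom walk)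

module SumSplit {A B : Set} where

  lefts : List (A ⊎ B) → List A
  lefts []             = []
  lefts (inj₁ a ∷ xs) = a ∷ lefts xs
  lefts (inj₂ _ ∷ xs) = lefts xs

  rights : List (A ⊎ B) → List B
  rights []             = []
  rights (inj₁ _ ∷ xs) = rights xs
  rights (inj₂ b ∷ xs) = b ∷ rights xs

  length-split : ∀ xs → length xs ≡ length (lefts xs) + length (rights xs)
  length-split []             = refl
  length-split (inj₁ _ ∷ xs) = cong suc (length-split xs)
  length-split (inj₂ _ ∷ xs) =
    trans (cong suc (length-split xs)) (sym (+-suc (length (lefts xs)) _))

  ∈-lefts : ∀ {a} xs → a ∈ lefts xs → inj₁ a ∈ xs
  ∈-lefts (inj₁ _ ∷ xs) (here refl) = here refl
  ∈-lefts (inj₁ _ ∷ xs) (there a∈)  = there (∈-lefts xs a∈)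
  ∈-lefts (inj₂ _ ∷ xs) a∈          = there (∈-lefts xs a∈)

  ∈-rights : ∀ {b} xs → b ∈ rights xs → inj₂ b ∈ xs
  ∈-rights (inj₂ _ ∷ xs) (here refl) = here refl
  ∈-rights (inj₂ _ ∷ xs) (there b∈)  = there (∈-rights xs b∈)
  ∈-rights (inj₁ _ ∷ xs) b∈          = there (∈-rights xs b∈)

  lefts-all≢ : ∀ {a} xs → All (inj₁ a ≢_) xs → All (a ≢_) (lefts xs)
  lefts-all≢ []             []         = []
  lefts-all≢ (inj₁ _ ∷ xs) (a≢ ∷ a≢s) = (λ eq → a≢ (cong inj₁ eq)) ∷ lefts-all≢ xs a≢s
  lefts-all≢ (inj₂ _ ∷ xs) (_  ∷ a≢s) = lefts-all≢ xs a≢s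

  rights-all≢ : ∀ {b} xs → All (inj₂ b ≢_) xs → All (b ≢_) (rights xs)
  rights-all≢ []             []         = []
  rights-all≢ (inj₂ _ ∷ xs) (b≢ ∷ b≢s) = (λ eq → b≢ (cong inj₂ eq)) ∷ rights-all≢ xs b≢s
  rights-all≢ (inj₁ _ ∷ xs) (_  ∷ b≢s) = rights-all≢ xs b≢s

  unique-lefts : ∀ xs → Unique xs → Unique (lefts xs)
  unique-lefts []             []        = []
  unique-lefts (inj₁ _ ∷ xs) (x∉ ∷ u) = lefts-all≢ xs x∉ ∷ unique-lefts xs u
  unique-lefts (inj₂ _ ∷ xs) (_  ∷ u) = unique-lefts xs u

  unique-rights : ∀ xs → Unique xs → Unique (rights xs)
  unique-rights []             []        = []
  unique-rights (inj₂ _ ∷ xs) (x∉ ∷ u) = rights-all≢ xs x∉ ∷ unique-rights xs u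
  unique-rights (inj₁ _ ∷ xs) (_  ∷ u) = unique-rights xs u

open SumSplit

scattered-cover-bound : {A C B : Set}
  {E₁ : A → A → Set} {E₂ : C → C → Set} {F : B → B → Set} {d m₁ m₂ : ℕ}
  (f : A → B) → Homomorphism E₁ F f → Injective f →
  (g : C → B) → Homomorphism E₂ F g → Injective g →
  (σ : B → A ⊎ C) → (∀ b → [ f , g ]′ (σ b) ≡ b) →
  IsOPT E₁ d m₁ → IsOPT E₂ d m₂ →
  ∀ K → Scattered F d K → length K ≤ m₁ + m₂
scattered-cover-bound f homf injf g homg injg σ section (_ , max₁) (_ , max₂) K scatK =
  subst (_≤ _) (trans (sym (length-split σK)) (length-map σ K))
    (+-mono-≤ (max₁ (lefts σK)
                (scattered-preimage f homf injf scatK (unique-lefts σK uniqueσK) leftsIn))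
              (max₂ (rights σK)
                (scattered-preimage g homg injg scatK (unique-rights σK uniqueσK) rightsIn)))
  where
  σK : List _
  σK = map σ K

  σ-injective : Injective σ
  σ-injective {b} {b′} eq = trans (sym (section b)) (trans (cong [ f , g ]′ eq) (section b′))

  uniqueσK : Unique σK
  uniqueσK = Unique.map⁺ σ-injective (proj₁ scatK)

  backIn : ∀ {s} → s ∈ σK → [ f , g ]′ s ∈ K
  backIn s∈ with ∈-map⁻ σ s∈
  ... | b , b∈K , refl = subst (_∈ K) (sym (section b)) b∈K

  leftsIn : ∀ {a} → a ∈ lefts σK → f a ∈ K
  leftsIn a∈ = backIn (∈-lefts σK a∈)

  rightsIn : ∀ {c} → c ∈ rights σK → g c ∈ K
  rightsIn c∈ = backIn (∈-rights σK c∈)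

module MergeCover (G₁ G₂ : Graph) (v₁ : Fin (Graph.n G₁)) (v₂ : Fin (Graph.n G₂))
                  {k : ℕ} (U : Fin k → Fin (Graph.n G₁)) (W : Fin k → Fin (Graph.n G₂)) where
  open Merge G₁ G₂ v₁ v₂ U W
  open Graph G₁ using () renaming (n to n₁; E to E₁; E-irr to E₁-irr)
  open Graph G₂ using () renaming (n to n₂; E to E₂; E-irr to E₂-irr)

  ι₁-injective : Injective ι₁
  ι₁-injective = inj₁-injective

  ι₂-injective : Injective ι₂
  ι₂-injective {x} {y} with x ≟ v₂ | y ≟ v₂
  ... | yes x≡v₂ | yes y≡v₂ = λ _ → trans x≡v₂ (sym y≡v₂)
  ... | yes _    | no _     = λ ()
  ... | no _     | yes _    = λ ()
  ... | no _     | no _     = λ eq → cong proj₁ (inj₂-injective eq)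

  ι₂-off-v₂ : ∀ a → ι₂ (proj₁ a) ≡ inj₂ a
  ι₂-off-v₂ a with proj₁ a ≟ v₂
  ... | yes a≡v₂ = ⊥-elim (toWitnessFalse (proj₂ a) a≡v₂)
  ... | no _     = cong (λ p → inj₂ (proj₁ a , p)) (T-irrelevant _ _)

  distinct-ends : {n : ℕ} (E : Fin n → Fin n → Set) → (∀ {x} → ¬ E x x) →
    {ι : Fin n → V'} → Injective ι → ∀ {x y} → E x y → ι x ≢ ι y
  distinct-ends E irr inj {x} e ιx≡ιy = irr (subst (E x) (sym (inj ιx≡ιy)) e)

  ι₁-hom : Homomorphism E₁ E' ι₁
  ι₁-hom {x} {y} e = distinct-ends E₁ E₁-irr ι₁-injective e , inj₁ (x , y , e , refl , refl)

  ι₂-hom : Homomorphism E₂ E' ι₂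
  ι₂-hom {x} {y} e = distinct-ends E₂ E₂-irr ι₂-injective e , inj₂ (inj₁ (x , y , e , refl , refl))

  origin : V' → Fin n₁ ⊎ Fin n₂
  origin (inj₁ x)       = inj₁ x
  origin (inj₂ (y , _)) = inj₂ y

  origin-section : ∀ a → [ ι₁ , ι₂ ]′ (origin a) ≡ a
  origin-section (inj₁ x) = refl
  origin-section (inj₂ a) = ι₂-off-v₂ a

lemma9 : (d : ℕ) → 1 ≤ d → (G₁ G₂ : Graph) →
    Connected (Graph.E G₁) → Connected (Graph.E G₂) →
    (v₁ : Fin (Graph.n G₁)) (v₂ : Fin (Graph.n G₂)) →
    (k : ℕ) (U : Fin k → Fin (Graph.n G₁)) (W : Fin k → Fin (Graph.n G₂)) →
    (m₁ m₂ m' : ℕ) →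
    IsOPT (Graph.E G₁) d m₁ → IsOPT (Graph.E G₂) d m₂ →
    IsOPT (Merge.E' G₁ G₂ v₁ v₂ U W) d m' →
    m' ≤ m₁ + m₂
lemma9 d _ G₁ G₂ _ _ v₁ v₂ k U W m₁ m₂ m' opt₁ opt₂ ((K , scatK , |K|≡m') , _) =
  subst (_≤ m₁ + m₂) |K|≡m'
    (scattered-cover-bound ι₁ ι₁-hom ι₁-injective ι₂ ι₂-hom ι₂-injective
                           origin origin-section opt₁ opt₂ K scatK)
  where
  open Merge G₁ G₂ v₁ v₂ U W using (ι₁; ι₂)
  open MergeCover G₁ G₂ v₁ v₂ U W
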